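{- For every integer $n\ge 3$, the prism graph $GP(n,1)$ is odd prime.
   Context: All graphs are finite and simple. An odd prime labeling of a graph $G$ with $N$ vertices is a bijection $\ell:V(G)\to\{1,3,\dots,2N-1\}$ such that $\gcd(\ell(u),\ell(v))=1$ for every edge $uv$; $G$ is odd prime if it has one. The prism graph $GP(n,1)$ has vertices $u_1,\dots,u_n,v_1,\dots,v_n$ and edges $u_iu_{i+1}$, $v_iv_{i+1}$ for $1\le i\le n-1$, $u_nu_1$, $v_nv_1$, and $u_iv_i$ for $1\le i\le n$. -}

module Defs where

open import Data.Nat using (ℕ; zero; suc; _+_; _*_; _<_; _≥_; _≤_)
open import Data.Nat.GCD using (gcd)
open import Data.Fin using (Fin; toℕ; zero; suc)
open import Data.Product using (Σ; ∃; _×_; _,_)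
open import Data.Sum using (_⊎_)
open import Relation.Binary.PropositionalEquality using (_≡_)
open import Relation.Nullary using (¬_)

-- A finite simple graph with N vertices: vertex type V (of cardinality N,
-- which the concrete instances guarantee), irreflexive symmetric adjacency.
record Graph : Set₁ where
  field
    V      : Set
    N      : ℕ
    Adj    : V → V → Set
    Adj-irrefl : ∀ {x} → ¬ Adj x x
    Adj-sym : ∀ {x y} → Adj x y → Adj y x
open Graph public

Odd : ℕ → Set
Odd m = ∃ λ k → m ≡ 2 * k + 1

record OddPrimeLabeling (G : Graph) : Set where
  field
    ℓ         : V G → ℕ
    ℓ-odd     : ∀ v → Odd (ℓ v)
    ℓ-bound   : ∀ v → ℓ v < 2 * N G
    ℓ-inj     : ∀ v w → ℓ v ≡ ℓ w → v ≡ w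
    ℓ-surj    : ∀ m → Odd m → m < 2 * N G → ∃ λ v → ℓ v ≡ m
    ℓ-coprime : ∀ v w → Adj G v w → gcd (ℓ v) (ℓ w) ≡ 1

IsOddPrime : Graph → Set
IsOddPrime G = OddPrimeLabeling G

-- Cycle adjacency on Fin n: i ~ j iff j = i+1 (mod n) or i = j+1 (mod n),
-- with indices 0..n-1 (index i stands for u_{i+1}, v_{i+1}).
CycSucc : (n : ℕ) → Fin n → Fin n → Set
CycSucc n i j = toℕ j ≡ suc (toℕ i) ⊎ (suc (toℕ i) ≡ n × toℕ j ≡ 0)

CycAdj : (n : ℕ) → Fin n → Fin n → Set
CycAdj n i j = CycSucc n i j ⊎ CycSucc n j i

-- Prism adjacency on {u,v} × Fin n (side zero = u, side suc zero = v):
-- same side and cycle-adjacent, or same index and different side (spoke u_i v_i).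
PrismAdj : (n : ℕ) → Fin 2 × Fin n → Fin 2 × Fin n → Set
PrismAdj n (s , i) (t , j) = (s ≡ t × CycAdj n i j) ⊎ (¬ s ≡ t × i ≡ j)

private
  open import Data.Nat using (_≤_; s≤s; z≤n)
  open import Data.Nat.Properties using (1+n≢n)
  open import Relation.Binary.PropositionalEquality using (trans; sym; cong; subst)
  open import Data.Sum using (inj₁; inj₂)
  open import Data.Empty using (⊥-elim)

  cyc-irr : ∀ {n} → 3 ≤ n → (i : Fin n) → ¬ CycSucc n i i
  cyc-irr h i (inj₁ e) = 1+n≢n (sym e)
  cyc-irr {n} h i (inj₂ (e , z)) = bad h (trans (sym e) (cong suc z))
    where
      bad : ∀ {m} → 3 ≤ m → ¬ m ≡ 1
      bad (s≤s (s≤s _)) ()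

  prism-irr : ∀ {n} → 3 ≤ n → ∀ {x} → ¬ PrismAdj n x x
  prism-irr h (inj₁ (_ , inj₁ c)) = cyc-irr h _ c
  prism-irr h (inj₁ (_ , inj₂ c)) = cyc-irr h _ c
  prism-irr h (inj₂ (ne , _)) = ne Relation.Binary.PropositionalEquality.refl

  prism-sym : ∀ {n x y} → PrismAdj n x y → PrismAdj n y x
  prism-sym (inj₁ (e , inj₁ c)) = inj₁ (sym e , inj₂ c)
  prism-sym (inj₁ (e , inj₂ c)) = inj₁ (sym e , inj₁ c)
  prism-sym (inj₂ (ne , e)) = inj₂ ((λ q → ne (sym q)) , sym e)

Prism : (n : ℕ) → 3 ≤ n → Graph
Prism n h = record
  { V = Fin 2 × Fin n
  ; N = 2 * n
  ; Adj = PrismAdj n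
  ; Adj-irrefl = prism-irr h
  ; Adj-sym = prism-sym
  }

-- Number the vertices u_i, v_i of GP(n,1) as 2i and 2i + 1 and give number j the label 2j + 1,
-- so u_i gets 4i + 1 and v_i gets 4i + 3. Along rungs and cycle steps the labels are odd and
-- differ by 2 or 4, hence coprime; the u-cycle closes at label 1, and the v-cycle closes with
-- labels 4n − 1 and 3. When 3 ∣ 4n − 1, exchange the labels of u_0 and v_0: the v-cycle then
-- closes at 1, the u-cycle with 4n − 3 and 3, coprime because 3 ∤ (4n − 1) − 2, and the new
-- edges at the first rung carry the pairs (3, 5) and (1, 7).
module Submission where

open import Defs
open import Data.Nat using (ℕ; zero; suc; _+_; _*_; _^_; _≤_; _<_; s≤s; z≤n)
open import Data.Nat.Properties
  using (+-comm; +-cancelʳ-≡; *-comm; *-monoʳ-≤; *-cancelˡ-≡; *-cancelˡ-<; ≤-<-trans; m≤m+n;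
         even≢odd; suc-injective)
open import Data.Nat.Divisibility
  using (_∣_; _∣?_; divides; ∣1⇒≡1; ∣-trans; ∣m+n∣m⇒∣n; >⇒∤)
open import Data.Nat.GCD using (gcd; gcd-comm; gcd-zeroʳ)
open import Data.Nat.Coprimality as Coprimality
  using (Coprime; coprime⇒gcd≡1; coprime-divisor; coprime-+)
open import Data.Nat.Primality using (Prime; prime[2]; prime?; prime⇒irreducible)
open import Data.Nat.Tactic.RingSolver using (solve-∀)
open import Data.Fin using (Fin; toℕ; fromℕ<; cast; combine; remQuot; zero; suc)
open import Data.Fin.Properties
  using (toℕ-injective; toℕ-fromℕ<; toℕ<n; toℕ-cast; toℕ-combine; cast-involutive;
         combine-remQuot; remQuot-combine)
open import Data.Product using (_×_; _,_; ∃; swap)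
open import Data.Sum using (inj₁; inj₂)
open import Data.Empty using (⊥-elim)
open import Data.Bool using (Bool; true; false)
open import Function.Bundles using (Inverse; _↔_; mk↔ₛ′)
open import Function.Construct.Composition using (_↔-∘_)
open import Relation.Nullary using (¬_; Dec; yes; no; does)
open import Relation.Nullary.Decidable using (toWitness)
open import Relation.Binary.PropositionalEquality

open Inverse

odd⇒¬2∣ : ∀ {m} → Odd m → ¬ 2 ∣ m
odd⇒¬2∣ (k , refl) (divides q eq) =
  even≢odd q k (trans (*-comm 2 q) (trans (sym eq) (+-comm (2 * k) 1)))

prime∤⇒coprime : ∀ {p m} → Prime p → ¬ p ∣ m → Coprime m p
prime∤⇒coprime p-prime p∤m (d∣m , d∣p) with prime⇒irreducible p-prime d∣p
... | inj₁ d≡1 = d≡1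
... | inj₂ refl = ⊥-elim (p∤m d∣m)

odd⇒coprime-2^ : ∀ {m} e → Odd m → Coprime m (2 ^ e)
odd⇒coprime-2^ zero    _     (_ , d∣1) = ∣1⇒≡1 d∣1
odd⇒coprime-2^ (suc e) m-odd {d} (d∣m , d∣2*2^e) =
  odd⇒coprime-2^ e m-odd (d∣m , coprime-divisor d-coprime-2 d∣2*2^e)
  where
  d-coprime-2 : Coprime d 2
  d-coprime-2 (c∣d , c∣2) = prime∤⇒coprime prime[2] (odd⇒¬2∣ m-odd) (∣-trans c∣d d∣m , c∣2)

gcd-odd-+2^ : ∀ e j → gcd (2 * j + 1) (2 * (2 ^ e + j) + 1) ≡ 1
gcd-odd-+2^ e j =
  coprime⇒gcd≡1 (subst (Coprime (2 * j + 1)) (sym (shift (2 ^ e) j)) coprime)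
  where
  shift : ∀ x j → 2 * (x + j) + 1 ≡ (2 * j + 1) + 2 * x
  shift = solve-∀
  coprime : Coprime (2 * j + 1) ((2 * j + 1) + 2 ^ suc e)
  coprime = Coprimality.sym (coprime-+ (Coprimality.sym (odd⇒coprime-2^ (suc e) (j , refl))))

double+1-< : ∀ {j N} → j < N → 2 * j + 1 < 2 * N
double+1-< {j} {N} j<N = subst (_≤ 2 * N) (eq j) (*-monoʳ-≤ 2 j<N)
  where
  eq : ∀ j → 2 * suc j ≡ suc (2 * j + 1)
  eq = solve-∀

double+1-<⁻¹ : ∀ {j N} → 2 * j + 1 < 2 * N → j < N
double+1-<⁻¹ {j} {N} lt = *-cancelˡ-< 2 j N (≤-<-trans (m≤m+n (2 * j) 1) lt)

double+1-injective : ∀ {j k} → 2 * j + 1 ≡ 2 * k + 1 → j ≡ k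
double+1-injective {j} {k} eq = *-cancelˡ-≡ j k 2 (+-cancelʳ-≡ 1 (2 * j) (2 * k) eq)

enumeration⇒oddPrimeLabeling : ∀ G (e : V G ↔ Fin (N G)) →
  (∀ v w → Adj G v w → gcd (2 * toℕ (to e v) + 1) (2 * toℕ (to e w) + 1) ≡ 1) →
  OddPrimeLabeling G
enumeration⇒oddPrimeLabeling G e coprime = record
  { ℓ         = ℓ
  ; ℓ-odd     = λ v → toℕ (to e v) , refl
  ; ℓ-bound   = λ v → double+1-< (toℕ<n (to e v))
  ; ℓ-inj     = ℓ-inj
  ; ℓ-surj    = ℓ-surj
  ; ℓ-coprime = coprime
  }
  where
  ℓ : V G → ℕ
  ℓ v = 2 * toℕ (to e v) + 1

  ℓ-inj : ∀ v w → ℓ v ≡ ℓ w → v ≡ w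
  ℓ-inj v w eq = begin
    v                ≡⟨ strictlyInverseʳ e v ⟨
    from e (to e v)  ≡⟨ cong (from e) (toℕ-injective (double+1-injective eq)) ⟩
    from e (to e w)  ≡⟨ strictlyInverseʳ e w ⟩
    w                ∎
    where open ≡-Reasoning

  ℓ-surj : ∀ m → Odd m → m < 2 * N G → ∃ λ v → ℓ v ≡ m
  ℓ-surj _ (k , refl) lt = from e j , cong (λ x → 2 * x + 1) toℕ[to[from[j]]]≡k
    where
    k<N : k < N G
    k<N = double+1-<⁻¹ lt
    j : Fin (N G)
    j = fromℕ< k<N
    toℕ[to[from[j]]]≡k : toℕ (to e (from e j)) ≡ k
    toℕ[to[from[j]]]≡k = trans (cong toℕ (strictlyInverseˡ e j)) (toℕ-fromℕ< k<N)

prismPosition : ∀ n → (Fin 2 × Fin n) ↔ Fin (2 * n)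
prismPosition n = mk↔ₛ′ to′ from′ to∘from from∘to
  where
  to′ : Fin 2 × Fin n → Fin (2 * n)
  to′ (s , i) = cast (*-comm n 2) (combine i s)

  from′ : Fin (2 * n) → Fin 2 × Fin n
  from′ j = swap (remQuot 2 (cast (*-comm 2 n) j))

  to∘from : ∀ j → to′ (from′ j) ≡ j
  to∘from j = trans (cong (cast (*-comm n 2)) (combine-remQuot {n} 2 (cast (*-comm 2 n) j)))
                    (cast-involutive (*-comm n 2) (*-comm 2 n) j)

  from∘to : ∀ v → from′ (to′ v) ≡ v
  from∘to (s , i) =
    cong swap (trans (cong (remQuot 2) (cast-involutive (*-comm 2 n) (*-comm n 2) (combine i s)))
                     (remQuot-combine i s))

toℕ-prismPosition : ∀ {n} s (i : Fin n) →
                    toℕ (to (prismPosition n) (s , i)) ≡ toℕ s + 2 * toℕ i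
toℕ-prismPosition {n} s i = trans (toℕ-cast (*-comm n 2) (combine i s))
                                  (trans (toℕ-combine i s) (+-comm (2 * toℕ i) (toℕ s)))

flipFirstRung : ∀ {n} → Bool → Fin 2 × Fin n → Fin 2 × Fin n
flipFirstRung false v                 = v
flipFirstRung true  (s , suc i)       = s , suc i
flipFirstRung true  (zero , zero)     = suc zero , zero
flipFirstRung true  (suc zero , zero) = zero , zero

flipFirstRung-involutive : ∀ {n} b (v : Fin 2 × Fin n) → flipFirstRung b (flipFirstRung b v) ≡ v
flipFirstRung-involutive false v                 = refl
flipFirstRung-involutive true  (zero , zero)     = refl
flipFirstRung-involutive true  (suc zero , zero) = refl
flipFirstRung-involutive true  (s , suc i)       = refl

prismEnumeration : Bool → ∀ n → (Fin 2 × Fin n) ↔ Fin (2 * n)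
prismEnumeration b n = prismPosition n ↔-∘ flip
  where
  flip : (Fin 2 × Fin n) ↔ (Fin 2 × Fin n)
  flip = mk↔ₛ′ (flipFirstRung b) (flipFirstRung b)
               (flipFirstRung-involutive b) (flipFirstRung-involutive b)

position : Bool → Fin 2 → ℕ → ℕ
position false s          a       = toℕ s + 2 * a
position true  s          (suc a) = toℕ s + 2 * suc a
position true  zero       zero    = 1
position true  (suc zero) zero    = 0

toℕ-prismEnumeration : ∀ b {n} s (i : Fin n) →
                       toℕ (to (prismEnumeration b n) (s , i)) ≡ position b s (toℕ i)
toℕ-prismEnumeration false     s          i       = toℕ-prismPosition s i
toℕ-prismEnumeration true  {n} zero       zero    = toℕ-prismPosition {n} (suc zero) zero
toℕ-prismEnumeration true  {n} (suc zero) zero    = toℕ-prismPosition {n} zero zero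
toℕ-prismEnumeration true      s          (suc i) = toℕ-prismPosition s (suc i)

label : Bool → Fin 2 → ℕ → ℕ
label b s a = 2 * position b s a + 1

gcd-odd-step : ∀ x a → gcd (2 * (x + 2 * a) + 1) (2 * (x + 2 * suc a) + 1) ≡ 1
gcd-odd-step x a = subst (λ y → gcd (2 * (x + 2 * a) + 1) (2 * y + 1) ≡ 1) (sym (shift x a))
                         (gcd-odd-+2^ 1 (x + 2 * a))
  where
  shift : ∀ x a → x + 2 * suc a ≡ 2 + (x + 2 * a)
  shift = solve-∀

rung-coprime : ∀ b a → gcd (label b zero a) (label b (suc zero) a) ≡ 1
rung-coprime false a       = gcd-odd-+2^ 0 (2 * a)
rung-coprime true  zero    = refl
rung-coprime true  (suc a) = gcd-odd-+2^ 0 (2 * suc a)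

step-coprime : ∀ b s a → gcd (label b s a) (label b s (suc a)) ≡ 1
step-coprime true  zero       zero    = refl
step-coprime true  (suc zero) zero    = refl
step-coprime true  s          (suc a) = gcd-odd-step (toℕ s) (suc a)
step-coprime false s          a       = gcd-odd-step (toℕ s) a

prime[3] : Prime 3
prime[3] = toWitness {a? = prime? 3} _

-- 4n − 1, the label of v_{n−1} before any flip, where n = k + 2
lastLabel : ℕ → ℕ
lastLabel k = label false (suc zero) (suc k)

wrap-coprime : ∀ k (3∣? : Dec (3 ∣ lastLabel k)) s →
               gcd (label (does 3∣?) s (suc k)) (label (does 3∣?) s 0) ≡ 1
wrap-coprime k (no 3∤last)  zero       = gcd-zeroʳ (label false zero (suc k))
wrap-coprime k (no 3∤last)  (suc zero) = coprime⇒gcd≡1 (prime∤⇒coprime prime[3] 3∤last)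
wrap-coprime k (yes 3∣last) zero       = coprime⇒gcd≡1 (prime∤⇒coprime prime[3] 3∤label)
  where
  lastLabel≡label+2 : ∀ k → 2 * (1 + 2 * suc k) + 1 ≡ (2 * (0 + 2 * suc k) + 1) + 2
  lastLabel≡label+2 = solve-∀
  3∤label : ¬ 3 ∣ label true zero (suc k)
  3∤label 3∣label =
    >⇒∤ (s≤s (s≤s (s≤s z≤n))) (∣m+n∣m⇒∣n (subst (3 ∣_) (lastLabel≡label+2 k) 3∣last) 3∣label)
wrap-coprime k (yes 3∣last) (suc zero) = gcd-zeroʳ (label true (suc zero) (suc k))

prismLabel : ∀ {n} → Bool → Fin 2 × Fin n → ℕ
prismLabel b (s , i) = label b s (toℕ i)

distinct-sides-coprime : ∀ b {s t} a → ¬ s ≡ t → gcd (label b s a) (label b t a) ≡ 1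
distinct-sides-coprime b {zero}     {zero}     a s≢t = ⊥-elim (s≢t refl)
distinct-sides-coprime b {zero}     {suc zero} a _   = rung-coprime b a
distinct-sides-coprime b {suc zero} {zero}     a _   =
  trans (gcd-comm (label b (suc zero) a) (label b zero a)) (rung-coprime b a)
distinct-sides-coprime b {suc zero} {suc zero} a s≢t = ⊥-elim (s≢t refl)

cycle-coprime : ∀ k (3∣? : Dec (3 ∣ lastLabel k)) s {i j : Fin (suc (suc k))} →
                CycSucc (suc (suc k)) i j →
                gcd (prismLabel (does 3∣?) (s , i)) (prismLabel (does 3∣?) (s , j)) ≡ 1
cycle-coprime k 3∣? s {i} (inj₁ j≡1+i) rewrite j≡1+i = step-coprime (does 3∣?) s (toℕ i)
cycle-coprime k 3∣? s (inj₂ (1+i≡n , j≡0))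
  rewrite j≡0 | suc-injective 1+i≡n = wrap-coprime k 3∣? s

prismLabel-coprime : ∀ k (3∣? : Dec (3 ∣ lastLabel k)) v w → PrismAdj (suc (suc k)) v w →
                     gcd (prismLabel (does 3∣?) v) (prismLabel (does 3∣?) w) ≡ 1
prismLabel-coprime k 3∣? (s , i) (.s , j) (inj₁ (refl , inj₁ i→j)) = cycle-coprime k 3∣? s i→j
prismLabel-coprime k 3∣? (s , i) (.s , j) (inj₁ (refl , inj₂ j→i)) =
  trans (gcd-comm (prismLabel (does 3∣?) (s , i)) (prismLabel (does 3∣?) (s , j)))
        (cycle-coprime k 3∣? s j→i)
prismLabel-coprime k 3∣? (s , i) (t , .i) (inj₂ (s≢t , refl)) =
  distinct-sides-coprime (does 3∣?) (toℕ i) s≢t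

prismEnumeration-coprime : ∀ k (3∣? : Dec (3 ∣ lastLabel k)) v w → PrismAdj (suc (suc k)) v w →
  let e = prismEnumeration (does 3∣?) (suc (suc k))
  in gcd (2 * toℕ (to e v) + 1) (2 * toℕ (to e w) + 1) ≡ 1
prismEnumeration-coprime k 3∣? (s , i) (t , j) adj
  rewrite toℕ-prismEnumeration (does 3∣?) s i | toℕ-prismEnumeration (does 3∣?) t j =
  prismLabel-coprime k 3∣? (s , i) (t , j) adj

mainTheorem5 : (n : ℕ) → (h : 3 ≤ n) → IsOddPrime (Prism n h)
mainTheorem5 (suc (suc (suc p))) h@(s≤s (s≤s (s≤s z≤n))) =
  enumeration⇒oddPrimeLabeling (Prism _ h) (prismEnumeration (does 3∣?) _)
    (prismEnumeration-coprime (suc p) 3∣?)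
  where
  3∣? : Dec (3 ∣ lastLabel (suc p))
  3∣? = 3 ∣? lastLabel (suc p)
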